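{- Let $n\ge1$ and let $C(r_A,r_B)$ be a ternary four-negacirculant code, where $r_A,r_B\in\mathbb{F}_3^n$. Then there exist $r_{A'},r_{B'}\in\mathbb{F}_3^n$ such that the four-negacirculant code $C(r_{A'},r_{B'})$ satisfies: (C1) $C(r_A,r_B)\cong C(r_{A'},r_{B'})$; (C2) the first nonzero component of $r_{A'}$ is $1$ and the first nonzero component of $r_{B'}$ is $1$ (for those of these vectors which are nonzero); (C3) $r_{A'}\ge r_{B'}$.
   Context: $\mathbb{F}_3=\{0,1,2\}$. For $r=(r_0,\dots,r_{n-1})\in\mathbb{F}_3^n$, the negacirculant matrix with first row $r$ is the $n\times n$ matrix whose $(i,j)$ entry ($0\le i,j\le n-1$) is $r_{j-i}$ if $j\ge i$ and $2r_{n+j-i}$ if $j<i$. For $r_A,r_B\in\mathbb{F}_3^n$ with negacirculant matrices $A,B$ having first rows $r_A,r_B$, the four-negacirculant code $C(r_A,r_B)=C(A,B)$ is the ternary $[4n,2n]$ code with generator matrix $\left(\, I_{2n} \;\middle|\; \begin{smallmatrix} A & B\\ 2B^T & A^T\end{smallmatrix}\right)$. Two codes $C,C'$ of length $m$ are equivalent ($C\cong C'$) if $C'=\{xP:x\in C\}$ for some $m\times m$ monomial matrix $P$ over $\mathbb{F}_3$. Ordering: for $a=(a_1,\dots,a_n)\in\mathbb{F}_3^n$ let $f(a)=\sum_{i=1}^n 3^{i-1}a_i\in\mathbb{Z}$, regarding $a_i\in\{0,1,2\}$ as integers; then $a\ge b$ means $f(a)\ge f(b)$. -}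

module Defs where

open import Data.Nat using (ℕ; zero; suc; _+_; _*_; _∸_; _^_; _≤ᵇ_)
open import Data.Fin using (Fin; toℕ; splitAt; _<_)
open import Data.Fin.Permutation using (Permutation′; _⟨$⟩ʳ_)
open import Data.Sum using (_⊎_; inj₁; inj₂)
open import Data.Product using (Σ; _×_; _,_; ∃)
open import Data.Bool using (if_then_else_)
open import Relation.Binary.PropositionalEquality using (_≡_; _≢_)
open import Relation.Nullary using (yes; no)
open import Function.Bundles using (_⇔_)

data F3 : Set where
  𝟘 𝟙 𝟚 : F3

infixl 6 _⊕_
infixl 7 _⊗_

_⊕_ : F3 → F3 → F3
𝟘 ⊕ y = y
𝟙 ⊕ 𝟘 = 𝟙
𝟙 ⊕ 𝟙 = 𝟚
𝟙 ⊕ 𝟚 = 𝟘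
𝟚 ⊕ 𝟘 = 𝟚
𝟚 ⊕ 𝟙 = 𝟘
𝟚 ⊕ 𝟚 = 𝟙

_⊗_ : F3 → F3 → F3
𝟘 ⊗ y = 𝟘
𝟙 ⊗ y = y
𝟚 ⊗ 𝟘 = 𝟘
𝟚 ⊗ 𝟙 = 𝟚
𝟚 ⊗ 𝟚 = 𝟙

val : F3 → ℕ
val 𝟘 = 0
val 𝟙 = 1
val 𝟚 = 2

Vec3 : ℕ → Set
Vec3 n = Fin n → F3

Mat3 : ℕ → ℕ → Set
Mat3 m k = Fin m → Fin k → F3

sumF : {n : ℕ} → (Fin n → F3) → F3
sumF {zero} f = 𝟘
sumF {suc n} f = f Data.Fin.zero ⊕ sumF (λ i → f (Data.Fin.suc i))

_·ᵥ_ : {m k : ℕ} → Vec3 m → Mat3 m k → Vec3 k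
(x ·ᵥ M) j = sumF (λ i → x i ⊗ M i j)

transpose : {m k : ℕ} → Mat3 m k → Mat3 k m
transpose M i j = M j i

-- component r_k of r (0-indexed) for a natural-number index k
-- (used only with k < n; returns 0 otherwise)
at : {n : ℕ} → Vec3 n → ℕ → F3
at {zero} r k = 𝟘
at {suc n} r zero = r Data.Fin.zero
at {suc n} r (suc k) = at (λ i → r (Data.Fin.suc i)) k

negacirc : {n : ℕ} → Vec3 n → Mat3 n n
negacirc {n} r i j =
  if toℕ i ≤ᵇ toℕ j
  then at r (toℕ j ∸ toℕ i)
  else 𝟚 ⊗ at r ((n + toℕ j) ∸ toℕ i)

block : {a b c d : ℕ} → Mat3 a c → Mat3 a d → Mat3 b c → Mat3 b d → Mat3 (a + b) (c + d)
block {a} {b} {c} {d} P Q R S i j with splitAt a i | splitAt c j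
... | inj₁ i' | inj₁ j' = P i' j'
... | inj₁ i' | inj₂ j' = Q i' j'
... | inj₂ i' | inj₁ j' = R i' j'
... | inj₂ i' | inj₂ j' = S i' j'

identity : {m : ℕ} → Mat3 m m
identity i j with i Data.Fin.≟ j
... | yes _ = 𝟙
... | no _ = 𝟘

scale : {m k : ℕ} → F3 → Mat3 m k → Mat3 m k
scale c M i j = c ⊗ M i j

-- generator matrix ( I_{2n} | A B ; 2B^T A^T ) of the four-negacirculant code,
-- a 2n × 4n matrix (length written as (n+n)+(n+n) = 4n)
genMat : {n : ℕ} → Vec3 n → Vec3 n → Mat3 (n + n) ((n + n) + (n + n))
genMat {n} rA rB i j with splitAt (n + n) j
... | inj₁ j' = identity i j'
... | inj₂ j' = block A B (scale 𝟚 (transpose B)) (transpose A) i j'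
  where
  A = negacirc rA
  B = negacirc rB

Code : ℕ → Set₁
Code m = Vec3 m → Set

rowSpace : {k m : ℕ} → Mat3 k m → Code m
rowSpace {k} G x = Σ (Vec3 k) λ u → ∀ j → x j ≡ (u ·ᵥ G) j

fourNegacirculant : {n : ℕ} → Vec3 n → Vec3 n → Code ((n + n) + (n + n))
fourNegacirculant rA rB = rowSpace (genMat rA rB)

IsMonomial : {m : ℕ} → Mat3 m m → Set
IsMonomial {m} P =
  Σ (Permutation′ m) λ σ → Σ (Vec3 m) λ c →
    (∀ i → c i ≢ 𝟘) ×
    (∀ i j → (j ≡ σ ⟨$⟩ʳ i → P i j ≡ c i) × (j ≢ σ ⟨$⟩ʳ i → P i j ≡ 𝟘))

_≅_ : {m : ℕ} → Code m → Code m → Set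
_≅_ {m} C C' =
  Σ (Mat3 m m) λ P → IsMonomial P ×
    (∀ y → C' y ⇔ (Σ (Vec3 m) λ x → C x × (∀ j → y j ≡ (x ·ᵥ P) j)))

-- f(a) = Σ_{i=1}^n 3^{i-1} a_i
weight3 : {n : ℕ} → Vec3 n → ℕ
weight3 {zero} a = 0
weight3 {suc n} a = val (a Data.Fin.zero) + 3 * weight3 (λ i → a (Data.Fin.suc i))

LeadingOne : {n : ℕ} → Vec3 n → Set
LeadingOne r = ∀ i → r i ≢ 𝟘 → (∀ j → j < i → r j ≡ 𝟘) → r i ≡ 𝟙

-- Multiplying the rows and columns of a generator matrix by units of F₃ and
-- permuting its columns yields the generator matrix of a monomially equivalent
-- code.  Replacing (r_A, r_B) by (a r_A, b r_B) for units a, b is such an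
-- operation: scale the two right-hand column blocks by a and b, the second row
-- block by ab, and use a² = b² = 1.  So is replacing (r_A, r_B) by (r_B, r_A):
-- exchange the two right-hand column blocks and negate the second row block.
-- Normalising r_A and r_B by their leading entries and swapping them if
-- necessary gives the theorem.

module Submission where

open import Defs
open import Data.Nat using (ℕ; zero; suc; _+_; _≤_; _≤?_; _≤ᵇ_; s≤s; z≤n)
open import Data.Bool using (true; false)
open import Data.Nat.Properties using (≰⇒>; <⇒≤)
open import Data.Fin as Fin using (Fin; splitAt; _≟_)
open import Data.Fin.Properties using (suc-injective; splitAt-join; +↔⊎)
open import Data.Fin.Permutation
  using (Permutation′; _⟨$⟩ʳ_; _⟨$⟩ˡ_; inverseˡ; inverseʳ; _∘ₚ_) renaming (id to idₚ)
open import Data.Sum using (_⊎_; inj₁; inj₂; swap; map₂)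
open import Data.Sum.Algebra using (⊎-comm)
open import Data.Sum.Function.Propositional using (_⊎-↔_)
open import Data.Product using (Σ; _×_; _,_)
open import Data.Vec.Functional using (map; tail; _++_)
open import Data.Vec.Functional.Relation.Unary.All.Properties using (++⁺)
open import Data.Empty using (⊥-elim)
open import Function using (_∘′_)
open import Function.Bundles using (_↔_; mk⇔)
open import Function.Properties.Inverse using (↔-refl; ↔-sym; ↔-trans)
open import Relation.Nullary using (yes; no)
open import Relation.Binary.PropositionalEquality
open ≡-Reasoning

⊕-comm : ∀ x y → x ⊕ y ≡ y ⊕ x
⊕-comm 𝟘 𝟘 = refl
⊕-comm 𝟘 𝟙 = refl
⊕-comm 𝟘 𝟚 = refl
⊕-comm 𝟙 𝟘 = refl
⊕-comm 𝟙 𝟙 = refl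
⊕-comm 𝟙 𝟚 = refl
⊕-comm 𝟚 𝟘 = refl
⊕-comm 𝟚 𝟙 = refl
⊕-comm 𝟚 𝟚 = refl

⊕-assoc : ∀ x y z → (x ⊕ y) ⊕ z ≡ x ⊕ (y ⊕ z)
⊕-assoc 𝟘 y z = refl
⊕-assoc 𝟙 𝟘 z = refl
⊕-assoc 𝟙 𝟙 𝟘 = refl
⊕-assoc 𝟙 𝟙 𝟙 = refl
⊕-assoc 𝟙 𝟙 𝟚 = refl
⊕-assoc 𝟙 𝟚 𝟘 = refl
⊕-assoc 𝟙 𝟚 𝟙 = refl
⊕-assoc 𝟙 𝟚 𝟚 = refl
⊕-assoc 𝟚 𝟘 z = refl
⊕-assoc 𝟚 𝟙 𝟘 = refl
⊕-assoc 𝟚 𝟙 𝟙 = refl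
⊕-assoc 𝟚 𝟙 𝟚 = refl
⊕-assoc 𝟚 𝟚 𝟘 = refl
⊕-assoc 𝟚 𝟚 𝟙 = refl
⊕-assoc 𝟚 𝟚 𝟚 = refl

⊕-interchange : ∀ w x y z → (w ⊕ x) ⊕ (y ⊕ z) ≡ (w ⊕ y) ⊕ (x ⊕ z)
⊕-interchange w x y z = begin
  (w ⊕ x) ⊕ (y ⊕ z)  ≡⟨ ⊕-assoc w x (y ⊕ z) ⟩
  w ⊕ (x ⊕ (y ⊕ z))  ≡⟨ cong (w ⊕_) (sym (⊕-assoc x y z)) ⟩
  w ⊕ ((x ⊕ y) ⊕ z)  ≡⟨ cong (λ t → w ⊕ (t ⊕ z)) (⊕-comm x y) ⟩
  w ⊕ ((y ⊕ x) ⊕ z)  ≡⟨ cong (w ⊕_) (⊕-assoc y x z) ⟩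
  w ⊕ (y ⊕ (x ⊕ z))  ≡⟨ sym (⊕-assoc w y (x ⊕ z)) ⟩
  (w ⊕ y) ⊕ (x ⊕ z)  ∎

⊗-comm : ∀ x y → x ⊗ y ≡ y ⊗ x
⊗-comm 𝟘 𝟘 = refl
⊗-comm 𝟘 𝟙 = refl
⊗-comm 𝟘 𝟚 = refl
⊗-comm 𝟙 𝟘 = refl
⊗-comm 𝟙 𝟙 = refl
⊗-comm 𝟙 𝟚 = refl
⊗-comm 𝟚 𝟘 = refl
⊗-comm 𝟚 𝟙 = refl
⊗-comm 𝟚 𝟚 = refl

⊗-assoc : ∀ x y z → (x ⊗ y) ⊗ z ≡ x ⊗ (y ⊗ z)
⊗-assoc 𝟘 y z = refl
⊗-assoc 𝟙 y z = refl
⊗-assoc 𝟚 𝟘 z = refl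
⊗-assoc 𝟚 𝟙 z = refl
⊗-assoc 𝟚 𝟚 𝟘 = refl
⊗-assoc 𝟚 𝟚 𝟙 = refl
⊗-assoc 𝟚 𝟚 𝟚 = refl

⊗-identityʳ : ∀ x → x ⊗ 𝟙 ≡ x
⊗-identityʳ x = ⊗-comm x 𝟙

⊗-zeroʳ : ∀ x → x ⊗ 𝟘 ≡ 𝟘
⊗-zeroʳ x = ⊗-comm x 𝟘

⊗-leftComm : ∀ x y z → x ⊗ (y ⊗ z) ≡ y ⊗ (x ⊗ z)
⊗-leftComm x y z = begin
  x ⊗ (y ⊗ z)  ≡⟨ sym (⊗-assoc x y z) ⟩
  (x ⊗ y) ⊗ z  ≡⟨ cong (_⊗ z) (⊗-comm x y) ⟩
  (y ⊗ x) ⊗ z  ≡⟨ ⊗-assoc y x z ⟩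
  y ⊗ (x ⊗ z)  ∎

⊗-distribˡ-⊕ : ∀ x y z → x ⊗ (y ⊕ z) ≡ x ⊗ y ⊕ x ⊗ z
⊗-distribˡ-⊕ 𝟘 y z = refl
⊗-distribˡ-⊕ 𝟙 y z = refl
⊗-distribˡ-⊕ 𝟚 𝟘 z = refl
⊗-distribˡ-⊕ 𝟚 𝟙 𝟘 = refl
⊗-distribˡ-⊕ 𝟚 𝟙 𝟙 = refl
⊗-distribˡ-⊕ 𝟚 𝟙 𝟚 = refl
⊗-distribˡ-⊕ 𝟚 𝟚 𝟘 = refl
⊗-distribˡ-⊕ 𝟚 𝟚 𝟙 = refl
⊗-distribˡ-⊕ 𝟚 𝟚 𝟚 = refl

data IsUnit : F3 → Set where
  𝟙-unit : IsUnit 𝟙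
  𝟚-unit : IsUnit 𝟚

unit⇒≢𝟘 : ∀ {u} → IsUnit u → u ≢ 𝟘
unit⇒≢𝟘 𝟙-unit ()
unit⇒≢𝟘 𝟚-unit ()

unit-selfInverse : ∀ {u} → IsUnit u → u ⊗ u ≡ 𝟙
unit-selfInverse 𝟙-unit = refl
unit-selfInverse 𝟚-unit = refl

unit-⊗ : ∀ {u v} → IsUnit u → IsUnit v → IsUnit (u ⊗ v)
unit-⊗ 𝟙-unit v = v
unit-⊗ 𝟚-unit 𝟙-unit = 𝟚-unit
unit-⊗ 𝟚-unit 𝟚-unit = 𝟙-unit

unit-cancelʳ : ∀ {v} → IsUnit v → ∀ u x → u ⊗ x ≡ (u ⊗ v) ⊗ (x ⊗ v)
unit-cancelʳ {v} v-unit u x = sym (begin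
  (u ⊗ v) ⊗ (x ⊗ v)  ≡⟨ ⊗-assoc u v (x ⊗ v) ⟩
  u ⊗ (v ⊗ (x ⊗ v))  ≡⟨ cong (u ⊗_) (⊗-leftComm v x v) ⟩
  u ⊗ (x ⊗ (v ⊗ v))  ≡⟨ cong (λ t → u ⊗ (x ⊗ t)) (unit-selfInverse v-unit) ⟩
  u ⊗ (x ⊗ 𝟙)        ≡⟨ cong (u ⊗_) (⊗-identityʳ x) ⟩
  u ⊗ x              ∎)

sumF-cong : ∀ {n} {f g : Fin n → F3} → (∀ i → f i ≡ g i) → sumF f ≡ sumF g
sumF-cong {zero}  f≗g = refl
sumF-cong {suc n} f≗g = cong₂ _⊕_ (f≗g Fin.zero) (sumF-cong (λ i → f≗g (Fin.suc i)))

sumF-zero : ∀ n → sumF {n} (λ _ → 𝟘) ≡ 𝟘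
sumF-zero zero    = refl
sumF-zero (suc n) = sumF-zero n

sumF-⊕ : ∀ {n} (f g : Fin n → F3) → sumF (λ i → f i ⊕ g i) ≡ sumF f ⊕ sumF g
sumF-⊕ {zero}  f g = refl
sumF-⊕ {suc n} f g = begin
  (f₀ ⊕ g₀) ⊕ sumF (λ i → tail f i ⊕ tail g i)  ≡⟨ cong ((f₀ ⊕ g₀) ⊕_) (sumF-⊕ (tail f) (tail g)) ⟩
  (f₀ ⊕ g₀) ⊕ (sumF (tail f) ⊕ sumF (tail g))   ≡⟨ ⊕-interchange f₀ g₀ _ _ ⟩
  sumF f ⊕ sumF g                               ∎
  where f₀ = f Fin.zero; g₀ = g Fin.zero

sumF-distribˡ : ∀ {n} x (f : Fin n → F3) → x ⊗ sumF f ≡ sumF (λ i → x ⊗ f i)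
sumF-distribˡ {zero}  x f = ⊗-zeroʳ x
sumF-distribˡ {suc n} x f = begin
  x ⊗ (f Fin.zero ⊕ sumF (tail f))        ≡⟨ ⊗-distribˡ-⊕ x _ _ ⟩
  x ⊗ f Fin.zero ⊕ x ⊗ sumF (tail f)      ≡⟨ cong (x ⊗ f Fin.zero ⊕_) (sumF-distribˡ x (tail f)) ⟩
  sumF (λ i → x ⊗ f i)                    ∎

sumF-distribʳ : ∀ {n} x (f : Fin n → F3) → sumF f ⊗ x ≡ sumF (λ i → f i ⊗ x)
sumF-distribʳ x f = begin
  sumF f ⊗ x            ≡⟨ ⊗-comm (sumF f) x ⟩
  x ⊗ sumF f            ≡⟨ sumF-distribˡ x f ⟩
  sumF (λ i → x ⊗ f i)  ≡⟨ sumF-cong (λ i → ⊗-comm x (f i)) ⟩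
  sumF (λ i → f i ⊗ x)  ∎

sumF-comm : ∀ {m n} (f : Fin m → Fin n → F3) →
  sumF (λ i → sumF (λ j → f i j)) ≡ sumF (λ j → sumF (λ i → f i j))
sumF-comm {zero}  {n} f = sym (sumF-zero n)
sumF-comm {suc m} f = begin
  sumF (f Fin.zero) ⊕ sumF (λ i → sumF (tail f i))         ≡⟨ cong (sumF (f Fin.zero) ⊕_) (sumF-comm (tail f)) ⟩
  sumF (f Fin.zero) ⊕ sumF (λ j → sumF (λ i → tail f i j))  ≡⟨ sym (sumF-⊕ (f Fin.zero) _) ⟩
  sumF (λ j → sumF (λ i → f i j))                          ∎

sumF-single : ∀ {n} (f : Fin n → F3) l → (∀ l′ → l′ ≢ l → f l′ ≡ 𝟘) → sumF f ≡ f l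
sumF-single {suc n} f Fin.zero f≡𝟘 = begin
  f Fin.zero ⊕ sumF (tail f)        ≡⟨ cong (f Fin.zero ⊕_) (sumF-cong (λ i → f≡𝟘 (Fin.suc i) (λ ()))) ⟩
  f Fin.zero ⊕ sumF {n} (λ _ → 𝟘)  ≡⟨ cong (f Fin.zero ⊕_) (sumF-zero n) ⟩
  f Fin.zero ⊕ 𝟘                   ≡⟨ ⊕-comm _ 𝟘 ⟩
  f Fin.zero                       ∎
sumF-single {suc n} f (Fin.suc l) f≡𝟘 =
  trans (cong (_⊕ sumF (tail f)) (f≡𝟘 Fin.zero (λ ())))
        (sumF-single (tail f) l (λ l′ l′≢l → f≡𝟘 (Fin.suc l′) (l′≢l ∘′ suc-injective)))

·ᵥ-cong : ∀ {k m} {u v : Vec3 k} → (∀ i → u i ≡ v i) → (M : Mat3 k m) → ∀ j → (u ·ᵥ M) j ≡ (v ·ᵥ M) j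
·ᵥ-cong u≗v M j = sumF-cong (λ i → cong (_⊗ M i j) (u≗v i))

_⋆_ : ∀ {k m p} → Mat3 k m → Mat3 m p → Mat3 k p
(G ⋆ P) i j = sumF (λ l → G i l ⊗ P l j)

·ᵥ-⋆ : ∀ {k m p} (w : Vec3 k) (G : Mat3 k m) (P : Mat3 m p) j →
  ((w ·ᵥ G) ·ᵥ P) j ≡ (w ·ᵥ (G ⋆ P)) j
·ᵥ-⋆ w G P j = begin
  sumF (λ l → sumF (λ i → w i ⊗ G i l) ⊗ P l j)      ≡⟨ sumF-cong (λ l → sumF-distribʳ (P l j) (λ i → w i ⊗ G i l)) ⟩
  sumF (λ l → sumF (λ i → (w i ⊗ G i l) ⊗ P l j))    ≡⟨ sumF-comm (λ l i → (w i ⊗ G i l) ⊗ P l j) ⟩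
  sumF (λ i → sumF (λ l → (w i ⊗ G i l) ⊗ P l j))    ≡⟨ sumF-cong (λ i → sumF-cong (λ l → ⊗-assoc (w i) (G i l) (P l j))) ⟩
  sumF (λ i → sumF (λ l → w i ⊗ (G i l ⊗ P l j)))    ≡⟨ sumF-cong (λ i → sym (sumF-distribˡ (w i) (λ l → G i l ⊗ P l j))) ⟩
  sumF (λ i → w i ⊗ sumF (λ l → G i l ⊗ P l j))      ∎

monomial : ∀ {m} → Permutation′ m → Vec3 m → Mat3 m m
monomial σ c i j with j ≟ σ ⟨$⟩ʳ i
... | yes _ = c i
... | no  _ = 𝟘

monomial-on : ∀ {m} (σ : Permutation′ m) c i j → j ≡ σ ⟨$⟩ʳ i → monomial σ c i j ≡ c i
monomial-on σ c i j j≡σi with j ≟ σ ⟨$⟩ʳ i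
... | yes _    = refl
... | no  j≢σi = ⊥-elim (j≢σi j≡σi)

monomial-off : ∀ {m} (σ : Permutation′ m) c i j → j ≢ σ ⟨$⟩ʳ i → monomial σ c i j ≡ 𝟘
monomial-off σ c i j j≢σi with j ≟ σ ⟨$⟩ʳ i
... | yes j≡σi = ⊥-elim (j≢σi j≡σi)
... | no  _    = refl

monomial-isMonomial : ∀ {m} (σ : Permutation′ m) c → (∀ i → c i ≢ 𝟘) → IsMonomial (monomial σ c)
monomial-isMonomial σ c c≢𝟘 =
  σ , c , c≢𝟘 , λ i j → monomial-on σ c i j , monomial-off σ c i j

⋆-monomial : ∀ {k m} (G : Mat3 k m) (σ : Permutation′ m) c i j →
  (G ⋆ monomial σ c) i j ≡ G i (σ ⟨$⟩ˡ j) ⊗ c (σ ⟨$⟩ˡ j)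
⋆-monomial G σ c i j =
  trans (sumF-single _ (σ ⟨$⟩ˡ j) off)
        (cong (G i (σ ⟨$⟩ˡ j) ⊗_) (monomial-on σ c _ j (sym (inverseʳ σ))))
  where
  off : ∀ l → l ≢ σ ⟨$⟩ˡ j → G i l ⊗ monomial σ c l j ≡ 𝟘
  off l l≢σ⁻¹j = trans (cong (G i l ⊗_) (monomial-off σ c l j j≢σl)) (⊗-zeroʳ (G i l))
    where
    j≢σl : j ≢ σ ⟨$⟩ʳ l
    j≢σl j≡σl = l≢σ⁻¹j (trans (sym (inverseˡ σ)) (cong (σ ⟨$⟩ˡ_) (sym j≡σl)))

-- G′ = D G P, with D the invertible diagonal matrix of rowScale and P the
-- monomial matrix of colPerm and colScale.
record _∼_ {k m} (G G′ : Mat3 k m) : Set where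
  field
    colPerm       : Permutation′ m
    colScale      : Vec3 m
    rowScale      : Vec3 k
    colScale-unit : ∀ l → IsUnit (colScale l)
    rowScale-unit : ∀ i → IsUnit (rowScale i)
    entries       : ∀ i l → G′ i (colPerm ⟨$⟩ʳ l) ≡ rowScale i ⊗ (G i l ⊗ colScale l)

∼-trans : ∀ {k m} {G G′ G″ : Mat3 k m} → G ∼ G′ → G′ ∼ G″ → G ∼ G″
∼-trans {G = G} {G′} {G″} r s = record
  { colPerm       = R.colPerm ∘ₚ S.colPerm
  ; colScale      = λ l → R.colScale l ⊗ S.colScale (R.colPerm ⟨$⟩ʳ l)
  ; rowScale      = λ i → S.rowScale i ⊗ R.rowScale i
  ; colScale-unit = λ l → unit-⊗ (R.colScale-unit l) (S.colScale-unit _)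
  ; rowScale-unit = λ i → unit-⊗ (S.rowScale-unit i) (R.rowScale-unit i)
  ; entries       = entries
  }
  where
  module R = _∼_ r
  module S = _∼_ s
  entries : ∀ i l → G″ i (S.colPerm ⟨$⟩ʳ (R.colPerm ⟨$⟩ʳ l)) ≡
            (S.rowScale i ⊗ R.rowScale i) ⊗ (G i l ⊗ (R.colScale l ⊗ S.colScale (R.colPerm ⟨$⟩ʳ l)))
  entries i l = begin
    G″ i (S.colPerm ⟨$⟩ʳ σl)                   ≡⟨ S.entries i σl ⟩
    f ⊗ (G′ i σl ⊗ e)                          ≡⟨ cong (λ t → f ⊗ (t ⊗ e)) (R.entries i l) ⟩
    f ⊗ ((d ⊗ (G i l ⊗ c)) ⊗ e)                ≡⟨ cong (f ⊗_) (⊗-assoc d (G i l ⊗ c) e) ⟩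
    f ⊗ (d ⊗ ((G i l ⊗ c) ⊗ e))                ≡⟨ cong (λ t → f ⊗ (d ⊗ t)) (⊗-assoc (G i l) c e) ⟩
    f ⊗ (d ⊗ (G i l ⊗ (c ⊗ e)))                ≡⟨ sym (⊗-assoc f d _) ⟩
    (f ⊗ d) ⊗ (G i l ⊗ (c ⊗ e))                ∎
    where
    σl = R.colPerm ⟨$⟩ʳ l
    f = S.rowScale i
    d = R.rowScale i
    c = R.colScale l
    e = S.colScale σl

∼⇒≅ : ∀ {k m} {G G′ : Mat3 k m} → G ∼ G′ → rowSpace G ≅ rowSpace G′
∼⇒≅ {k} {m} {G} {G′} r =
  P , monomial-isMonomial σ c (λ l → unit⇒≢𝟘 (colScale-unit l)) , λ y → mk⇔ (to y) (from y)
  where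
  open _∼_ r renaming (colPerm to σ; colScale to c; rowScale to d)
  P = monomial σ c

  G′≡DGP : ∀ i j → G′ i j ≡ d i ⊗ (G ⋆ P) i j
  G′≡DGP i j = begin
    G′ i j                                      ≡⟨ cong (G′ i) (sym (inverseʳ σ)) ⟩
    G′ i (σ ⟨$⟩ʳ (σ ⟨$⟩ˡ j))                     ≡⟨ entries i (σ ⟨$⟩ˡ j) ⟩
    d i ⊗ (G i (σ ⟨$⟩ˡ j) ⊗ c (σ ⟨$⟩ˡ j))        ≡⟨ cong (d i ⊗_) (sym (⋆-monomial G σ c i j)) ⟩
    d i ⊗ (G ⋆ P) i j                           ∎

  _⊙d : Vec3 k → Vec3 k
  (u ⊙d) i = u i ⊗ d i

  ·ᵥG′ : ∀ u j → (u ·ᵥ G′) j ≡ ((u ⊙d) ·ᵥ (G ⋆ P)) j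
  ·ᵥG′ u j = begin
    sumF (λ i → u i ⊗ G′ i j)               ≡⟨ sumF-cong (λ i → cong (u i ⊗_) (G′≡DGP i j)) ⟩
    sumF (λ i → u i ⊗ (d i ⊗ (G ⋆ P) i j))  ≡⟨ sumF-cong (λ i → sym (⊗-assoc (u i) (d i) _)) ⟩
    ((u ⊙d) ·ᵥ (G ⋆ P)) j                   ∎

  ⊙d-involutive : ∀ u i → ((u ⊙d) ⊙d) i ≡ u i
  ⊙d-involutive u i = trans (⊗-assoc (u i) (d i) (d i))
    (trans (cong (u i ⊗_) (unit-selfInverse (rowScale-unit i))) (⊗-identityʳ (u i)))

  Image : Code m
  Image y = Σ (Vec3 m) λ x → rowSpace G x × (∀ j → y j ≡ (x ·ᵥ P) j)

  to : ∀ y → rowSpace G′ y → Image y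
  to y (u , y≡uG′) = (u ⊙d) ·ᵥ G , (u ⊙d , λ _ → refl) , λ j →
    trans (y≡uG′ j) (trans (·ᵥG′ u j) (sym (·ᵥ-⋆ (u ⊙d) G P j)))

  from : ∀ y → Image y → rowSpace G′ y
  from y (x , (v , x≡vG) , y≡xP) = v ⊙d , λ j → begin
    y j                          ≡⟨ y≡xP j ⟩
    (x ·ᵥ P) j                   ≡⟨ ·ᵥ-cong x≡vG P j ⟩
    ((v ·ᵥ G) ·ᵥ P) j            ≡⟨ ·ᵥ-⋆ v G P j ⟩
    (v ·ᵥ (G ⋆ P)) j             ≡⟨ ·ᵥ-cong (λ i → sym (⊙d-involutive v i)) (G ⋆ P) j ⟩
    (((v ⊙d) ⊙d) ·ᵥ (G ⋆ P)) j   ≡⟨ sym (·ᵥG′ (v ⊙d) j) ⟩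
    ((v ⊙d) ·ᵥ G′) j             ∎

module _ {a b c d : ℕ} {P P′ : Mat3 a c} {Q Q′ : Mat3 a d} {R R′ : Mat3 b c} {S S′ : Mat3 b d}
         {d₁ : Vec3 a} {d₂ : Vec3 b} {c₁ : Vec3 c} {c₂ : Vec3 d} where

  block-rescale :
    (∀ i j → P′ i j ≡ d₁ i ⊗ (P i j ⊗ c₁ j)) → (∀ i j → Q′ i j ≡ d₁ i ⊗ (Q i j ⊗ c₂ j)) →
    (∀ i j → R′ i j ≡ d₂ i ⊗ (R i j ⊗ c₁ j)) → (∀ i j → S′ i j ≡ d₂ i ⊗ (S i j ⊗ c₂ j)) →
    ∀ i j → block P′ Q′ R′ S′ i j ≡ (d₁ ++ d₂) i ⊗ (block P Q R S i j ⊗ (c₁ ++ c₂) j)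
  block-rescale P′≡ Q′≡ R′≡ S′≡ i j with splitAt a i | splitAt c j
  ... | inj₁ i′ | inj₁ j′ = P′≡ i′ j′
  ... | inj₁ i′ | inj₂ j′ = Q′≡ i′ j′
  ... | inj₂ i′ | inj₁ j′ = R′≡ i′ j′
  ... | inj₂ i′ | inj₂ j′ = S′≡ i′ j′

onSummands : ∀ {k m} → (Fin k ⊎ Fin m) ↔ (Fin k ⊎ Fin m) → Permutation′ (k + m)
onSummands φ = ↔-trans +↔⊎ (↔-trans φ (↔-sym +↔⊎))

swapHalves : ∀ {c} → Permutation′ (c + c)
swapHalves {c} = onSummands {c} {c} (⊎-comm _ _)

block-swapHalves : ∀ {a b c} (P Q : Mat3 a c) (R S : Mat3 b c) i j →
  block P Q R S i (swapHalves {c} ⟨$⟩ʳ j) ≡ block Q P S R i j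
block-swapHalves {a} {b} {c} P Q R S i j
  rewrite splitAt-join c c (swap (splitAt c j)) with splitAt a i | splitAt c j
... | inj₁ i′ | inj₁ j′ = refl
... | inj₁ i′ | inj₂ j′ = refl
... | inj₂ i′ | inj₁ j′ = refl
... | inj₂ i′ | inj₂ j′ = refl

[I∣_] : ∀ {k m} → Mat3 k m → Mat3 k (k + m)
[I∣ M ] i = identity i ++ M i

identity-rescale : ∀ {m} {d : Vec3 m} → (∀ i → IsUnit (d i)) →
  ∀ i j → identity i j ≡ d i ⊗ (identity i j ⊗ d j)
identity-rescale {d = d} d-unit i j with i ≟ j
... | yes refl = sym (unit-selfInverse (d-unit i))
... | no  _    = sym (⊗-zeroʳ (d i))

[I∣]-∼ : ∀ {k m} {M M′ : Mat3 k m} → M ∼ M′ → [I∣ M ] ∼ [I∣ M′ ]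
[I∣]-∼ {k} {m} {M} {M′} r = record
  { colPerm       = onSummands (↔-refl ⊎-↔ colPerm)
  ; colScale      = rowScale ++ colScale
  ; rowScale      = rowScale
  ; colScale-unit = ++⁺ IsUnit rowScale-unit colScale-unit
  ; rowScale-unit = rowScale-unit
  ; entries       = entries′
  }
  where
  open _∼_ r
  entries′ : ∀ i l → [I∣ M′ ] i (onSummands (↔-refl ⊎-↔ colPerm) ⟨$⟩ʳ l) ≡
             rowScale i ⊗ ([I∣ M ] i l ⊗ (rowScale ++ colScale) l)
  entries′ i l rewrite splitAt-join k m (map₂ (colPerm ⟨$⟩ʳ_) (splitAt k l)) with splitAt k l
  ... | inj₁ j = identity-rescale rowScale-unit i j
  ... | inj₂ j = entries i j

at-map : ∀ {n} x (r : Vec3 n) k → at (map (x ⊗_) r) k ≡ x ⊗ at r k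
at-map {zero}  x r k       = sym (⊗-zeroʳ x)
at-map {suc n} x r zero    = refl
at-map {suc n} x r (suc k) = at-map x (tail r) k

negacirc-map : ∀ {n} x (r : Vec3 n) i j → negacirc (map (x ⊗_) r) i j ≡ x ⊗ negacirc r i j
negacirc-map x r i j with Fin.toℕ i ≤ᵇ Fin.toℕ j
... | true  = at-map x r _
... | false = trans (cong (𝟚 ⊗_) (at-map x r _)) (⊗-leftComm 𝟚 x _)

negaBlock : ∀ {n} → Vec3 n → Vec3 n → Mat3 (n + n) (n + n)
negaBlock rA rB = block A B (scale 𝟚 (transpose B)) (transpose A)
  where
  A = negacirc rA
  B = negacirc rB

genMat≡[I∣negaBlock] : ∀ {n} (rA rB : Vec3 n) i j → genMat rA rB i j ≡ [I∣ negaBlock rA rB ] i j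
genMat≡[I∣negaBlock] {n} rA rB i j with splitAt (n + n) j
... | inj₁ _ = refl
... | inj₂ _ = refl

genMat-∼ : ∀ {n} {rA rB rA′ rB′ : Vec3 n} →
  negaBlock rA rB ∼ negaBlock rA′ rB′ → genMat rA rB ∼ genMat rA′ rB′
genMat-∼ {rA = rA} {rB} {rA′} {rB′} r = record
  { _∼_ ([I∣]-∼ r) hiding (entries)
  ; entries = λ i l → begin
      genMat rA′ rB′ i (colPerm ⟨$⟩ʳ l)                      ≡⟨ genMat≡[I∣negaBlock] rA′ rB′ i _ ⟩
      [I∣ negaBlock rA′ rB′ ] i (colPerm ⟨$⟩ʳ l)             ≡⟨ entries i l ⟩
      rowScale i ⊗ ([I∣ negaBlock rA rB ] i l ⊗ colScale l)  ≡⟨ cong (λ t → rowScale i ⊗ (t ⊗ colScale l))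
                                                                    (sym (genMat≡[I∣negaBlock] rA rB i l)) ⟩
      rowScale i ⊗ (genMat rA rB i l ⊗ colScale l)           ∎
  }
  where open _∼_ ([I∣]-∼ r)

halves : ∀ {n} → F3 → F3 → Vec3 (n + n)
halves {n} x y = _++_ {m = n} (λ _ → x) (λ _ → y)

halves-unit : ∀ {n x y} → IsUnit x → IsUnit y → ∀ i → IsUnit (halves {n} x y i)
halves-unit {n} x-unit y-unit = ++⁺ {m = n} IsUnit (λ _ → x-unit) (λ _ → y-unit)

negaBlock-rescale : ∀ {n} {a b} (rA rB : Vec3 n) → IsUnit a → IsUnit b →
  negaBlock rA rB ∼ negaBlock (map (a ⊗_) rA) (map (b ⊗_) rB)
negaBlock-rescale {n} {a} {b} rA rB a-unit b-unit = record
  { colPerm       = idₚ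
  ; colScale      = halves {n} a b
  ; rowScale      = halves {n} 𝟙 (a ⊗ b)
  ; colScale-unit = halves-unit {n} a-unit b-unit
  ; rowScale-unit = halves-unit {n} 𝟙-unit (unit-⊗ a-unit b-unit)
  ; entries       = block-rescale A′ B′ 2B′ᵀ A′ᵀ
  }
  where
  A′ : ∀ i j → negacirc (map (a ⊗_) rA) i j ≡ 𝟙 ⊗ (negacirc rA i j ⊗ a)
  A′ i j = trans (negacirc-map a rA i j) (⊗-comm a _)
  B′ : ∀ i j → negacirc (map (b ⊗_) rB) i j ≡ 𝟙 ⊗ (negacirc rB i j ⊗ b)
  B′ i j = trans (negacirc-map b rB i j) (⊗-comm b _)
  2B′ᵀ : ∀ i j → 𝟚 ⊗ negacirc (map (b ⊗_) rB) j i ≡ (a ⊗ b) ⊗ ((𝟚 ⊗ negacirc rB j i) ⊗ a)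
  2B′ᵀ i j = begin
    𝟚 ⊗ negacirc (map (b ⊗_) rB) j i  ≡⟨ cong (𝟚 ⊗_) (negacirc-map b rB j i) ⟩
    𝟚 ⊗ (b ⊗ x)                       ≡⟨ ⊗-leftComm 𝟚 b x ⟩
    b ⊗ (𝟚 ⊗ x)                       ≡⟨ unit-cancelʳ a-unit b (𝟚 ⊗ x) ⟩
    (b ⊗ a) ⊗ ((𝟚 ⊗ x) ⊗ a)           ≡⟨ cong (_⊗ ((𝟚 ⊗ x) ⊗ a)) (⊗-comm b a) ⟩
    (a ⊗ b) ⊗ ((𝟚 ⊗ x) ⊗ a)           ∎
    where x = negacirc rB j i
  A′ᵀ : ∀ i j → negacirc (map (a ⊗_) rA) j i ≡ (a ⊗ b) ⊗ (negacirc rA j i ⊗ b)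
  A′ᵀ i j = trans (negacirc-map a rA j i) (unit-cancelʳ b-unit a _)

negaBlock-swap : ∀ {n} (rA rB : Vec3 n) → negaBlock rA rB ∼ negaBlock rB rA
negaBlock-swap {n} rA rB = record
  { colPerm       = swapHalves {n}
  ; colScale      = halves {n} 𝟙 𝟙
  ; rowScale      = halves {n} 𝟙 𝟚
  ; colScale-unit = halves-unit {n} 𝟙-unit 𝟙-unit
  ; rowScale-unit = halves-unit {n} 𝟙-unit 𝟚-unit
  ; entries       = λ i l → trans (block-swapHalves B A (scale 𝟚 (transpose A)) (transpose B) i l)
                                  (block-rescale {n} {n} {n} {n} (unchanged A) (unchanged B) negated-twice negated i l)
  }
  where
  A = negacirc rA
  B = negacirc rB
  unchanged : ∀ {p q} (M : Mat3 p q) i j → M i j ≡ 𝟙 ⊗ (M i j ⊗ 𝟙)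
  unchanged M i j = sym (⊗-identityʳ (M i j))
  negated : ∀ i j → 𝟚 ⊗ A j i ≡ 𝟚 ⊗ (A j i ⊗ 𝟙)
  negated i j = cong (𝟚 ⊗_) (unchanged A j i)
  negated-twice : ∀ i j → B j i ≡ 𝟚 ⊗ ((𝟚 ⊗ B j i) ⊗ 𝟙)
  negated-twice i j with B j i
  ... | 𝟘 = refl
  ... | 𝟙 = refl
  ... | 𝟚 = refl

-- The first nonzero entry of r, and 𝟙 for the zero vector.  Every unit of F₃ is
-- its own inverse, so scaling r by it makes the first nonzero entry 𝟙.
leading : ∀ {n} → Vec3 n → F3
leading {zero}  r = 𝟙
leading {suc n} r with r Fin.zero
... | 𝟘 = leading (tail r)
... | 𝟙 = 𝟙
... | 𝟚 = 𝟚

leading-unit : ∀ {n} (r : Vec3 n) → IsUnit (leading r)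
leading-unit {zero}  r = 𝟙-unit
leading-unit {suc n} r with r Fin.zero
... | 𝟘 = leading-unit (tail r)
... | 𝟙 = 𝟙-unit
... | 𝟚 = 𝟚-unit

normalise : ∀ {n} → Vec3 n → Vec3 n
normalise r = map (leading r ⊗_) r

normalise-leadingOne : ∀ {n} (r : Vec3 n) → LeadingOne (normalise r)
normalise-leadingOne {suc n} r i r′ᵢ≢𝟘 before with r Fin.zero in r₀≡
normalise-leadingOne {suc n} r Fin.zero    r′ᵢ≢𝟘 _      | 𝟘 =
  ⊥-elim (r′ᵢ≢𝟘 (trans (cong (leading (tail r) ⊗_) r₀≡) (⊗-zeroʳ _)))
normalise-leadingOne {suc n} r (Fin.suc i) r′ᵢ≢𝟘 before | 𝟘 =
  normalise-leadingOne (tail r) i r′ᵢ≢𝟘 (λ j j<i → before (Fin.suc j) (s≤s j<i))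
normalise-leadingOne {suc n} r Fin.zero    _ _      | 𝟙 = cong (𝟙 ⊗_) r₀≡
normalise-leadingOne {suc n} r (Fin.suc i) _ before | 𝟙
  with () ← trans (sym (cong (𝟙 ⊗_) r₀≡)) (before Fin.zero (s≤s z≤n))
normalise-leadingOne {suc n} r Fin.zero    _ _      | 𝟚 = cong (𝟚 ⊗_) r₀≡
normalise-leadingOne {suc n} r (Fin.suc i) _ before | 𝟚
  with () ← trans (sym (cong (𝟚 ⊗_) r₀≡)) (before Fin.zero (s≤s z≤n))

negaBlock-normalise : ∀ {n} (rA rB : Vec3 n) → negaBlock rA rB ∼ negaBlock (normalise rA) (normalise rB)
negaBlock-normalise rA rB = negaBlock-rescale rA rB (leading-unit rA) (leading-unit rB)

lemma3p2 : (n : ℕ) → 1 ≤ n → (rA rB : Vec3 n) →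
    Σ (Vec3 n) λ rA' → Σ (Vec3 n) λ rB' →
      (fourNegacirculant rA rB ≅ fourNegacirculant rA' rB') ×
      LeadingOne rA' × LeadingOne rB' ×
      weight3 rB' ≤ weight3 rA'
lemma3p2 n _ rA rB with weight3 (normalise rB) ≤? weight3 (normalise rA)
... | yes rB′≤rA′ =
  normalise rA , normalise rB ,
  ∼⇒≅ (genMat-∼ {n} (negaBlock-normalise rA rB)) ,
  normalise-leadingOne rA , normalise-leadingOne rB , rB′≤rA′
... | no  rB′≰rA′ =
  normalise rB , normalise rA ,
  ∼⇒≅ (genMat-∼ {n} (∼-trans (negaBlock-normalise rA rB)
                              (negaBlock-swap (normalise rA) (normalise rB)))) ,
  normalise-leadingOne rB , normalise-leadingOne rA , <⇒≤ (≰⇒> rB′≰rA′)
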